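{- Let $p>3$ be a prime and $\kappa\in\mathbb{Z}$. If there exists $n\in\mathbb{Z}_{>0}$ such that $\mathcal{K}^{\mathrm{prop}}_{n,\kappa}(p)\ne\emptyset$, then $\mathcal{G}_\kappa(p)$ contains cycles (closed paths with no repeated vertices or edges) of lengths $4n+2$, $6n+3$, and $8n+2$.
   Context: Let $p>3$ be a prime and $\kappa\in\mathbb{Z}$, regarded as an element of $\mathbb{F}_p$. Let $\mathcal{M}_\kappa(p)=\{(x,y,z)\in\mathbb{F}_p^3 : x^2+y^2+z^2=xyz+\kappa\}$, with Vieta involutions $R_1(x,y,z)=(yz-x,y,z)$, $R_2(x,y,z)=(x,zx-y,z)$, $R_3(x,y,z)=(x,y,xy-z)$. $\mathcal{G}_\kappa(p)$ is the $3$-regular graph (possibly with loops) on $\mathcal{M}_\kappa(p)$ with an edge joining $X$ and $R_i(X)$ for each $X$ and $i$. Compositions $R_iR_j$ mean apply $R_j$ first. For $n\in\mathbb{Z}_{>0}$, $\mathcal{K}^{\mathrm{all}}_{n,\kappa}(p)$ is the set of sextuples $(X_1,X_2,X_3;Y_1,Y_2,Y_3)$ in $\mathcal{M}_\kappa(p)$ with $Y_1=R_1(X_1)=(R_2R_1)^n(X_2)=(R_3R_1)^n(X_3)$, $Y_2=R_2(X_2)=(R_3R_2)^n(X_3)=(R_1R_2)^n(X_1)$, $Y_3=R_3(X_3)=(R_1R_3)^n(X_1)=(R_2R_3)^n(X_2)$. For $i\ne j$ the $X_i$-$Y_j$-path is $(X_i,R_j(X_i),(R_iR_j)(X_i),\dots,R_j(R_iR_j)^{n-1}(X_i),(R_iR_j)^n(X_i)=Y_j)$.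 $\mathcal{K}^{\mathrm{prop}}_{n,\kappa}(p)$ is the set of those sextuples whose six triples are pairwise distinct and such that none of the six triples is an internal vertex of any $X_i$-$Y_j$-path with $i\ne j$. -}

module Defs where

open import Data.Nat using (ℕ; zero; suc; _+_; _*_; _∸_; _<_; NonZero)
open import Data.Nat.DivMod using (_mod_)
open import Data.Integer using (ℤ)
open import Data.Integer.DivMod using (_%ℕ_)
open import Data.Fin using (Fin; toℕ; zero; suc)
open import Data.Product using (Σ; ∃; _×_; _,_)
open import Data.Sum using (_⊎_)
open import Relation.Binary.PropositionalEquality using (_≡_; _≢_)
open import Relation.Nullary using (¬_)
open import Function.Definitions using (Injective)

module _ (p : ℕ) .{{_ : NonZero p}} where

  F : Set
  F = Fin p

  infixl 6 _⊕_ _⊖_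
  infixl 7 _⊗_

  _⊕_ : F → F → F
  a ⊕ b = (toℕ a + toℕ b) mod p

  _⊗_ : F → F → F
  a ⊗ b = (toℕ a * toℕ b) mod p

  _⊖_ : F → F → F
  a ⊖ b = (toℕ a + (p ∸ toℕ b)) mod p

  ⟦_⟧ : ℤ → F
  ⟦ k ⟧ = (k %ℕ p) mod p

  Triple : Set
  Triple = F × F × F

  InM : ℤ → Triple → Set
  InM κ (x , y , z) = x ⊗ x ⊕ y ⊗ y ⊕ z ⊗ z ≡ x ⊗ y ⊗ z ⊕ ⟦ κ ⟧

  -- Vieta involutions R₁, R₂, R₃ (indexed by Fin 3 : zero ↦ R₁, ...)
  R : Fin 3 → Triple → Triple
  R zero (x , y , z) = (y ⊗ z ⊖ x , y , z)
  R (suc zero) (x , y , z) = (x , z ⊗ x ⊖ y , z)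
  R (suc (suc zero)) (x , y , z) = (x , y , x ⊗ y ⊖ z)

  -- alt i j X m is the m-th vertex of the alternating walk
  -- X, R_j X, R_i R_j X, R_j R_i R_j X, ...
  -- so alt i j X (2n) = (R_i R_j)^n X and the X_i–Y_j path is
  -- alt i j X 0, ..., alt i j X (2n).
  alt : Fin 3 → Fin 3 → Triple → ℕ → Triple
  alt i j X zero = X
  alt i j X (suc m) = alt j i (R j X) m

  InKall : ℕ → ℤ → (Fin 3 → Triple) → (Fin 3 → Triple) → Set
  InKall n κ X Y =
    (∀ i → InM κ (X i)) × (∀ i → InM κ (Y i)) ×
    (∀ j → Y j ≡ R j (X j)) ×
    (∀ i j → i ≢ j → alt i j (X i) (2 * n) ≡ Y j)

  InKprop : ℕ → ℤ → (Fin 3 → Triple) → (Fin 3 → Triple) → Set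
  InKprop n κ X Y =
    InKall n κ X Y ×
    Injective _≡_ _≡_ X × Injective _≡_ _≡_ Y × (∀ i k → X i ≢ Y k) ×
    (∀ i j → i ≢ j → ∀ m → 0 < m → m < 2 * n →
       ∀ k → alt i j (X i) m ≢ X k × alt i j (X i) m ≢ Y k)

  Adj : Triple → Triple → Set
  Adj V W = ∃ λ i → W ≡ R i V

  HasCycle : ℤ → ℕ → Set
  HasCycle κ L =
    Σ (Fin L → Triple) λ v →
      (∀ k → InM κ (v k)) × Injective _≡_ _≡_ v ×
      (∀ (k k' : Fin L) →
         (suc (toℕ k) ≡ toℕ k' ⊎ (suc (toℕ k) ≡ L × toℕ k' ≡ 0)) →
         Adj (v k) (v k'))

module Submission where

-- For i ≠ j, the walk from X_i that alternately applies R_j and R_i reaches Y_j after 2n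
-- steps and X_j after 2n + 1; it then runs along the X_j–Y_i path back to X_i, closing a
-- loop of length 4n + 2. The loop is an orbit of the dihedral group ⟨R_i, R_j⟩, so a repeated
-- vertex would bring X_i back by a rotation or a reflection, and properness puts X_i only at
-- the start: the loop is a cycle. Along it the coordinate other than i, j is constant, while a
-- point of M_κ(p) is determined up to R_e by its coordinates other than the e-th (a quadratic
-- over the field F_p). So two such walks can only meet in some X_e or Y_e, whose positions are
-- known. This yields the loop of ⟨R₁, R₂⟩ (length 4n + 2), the triangle X₁ → X₃ → X₂ → X₁ of
-- three half-loops (6n + 3), and the loops of ⟨R₁, R₂⟩ and ⟨R₂, R₃⟩ through X₂, which share
-- only the edge X₂Y₂ and merge into a cycle of length 8n + 2.
--
-- Identities in F_p are checked in ℤ modulo p, where the ring solver applies.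

open import Level using (0ℓ)
open import Data.Empty using (⊥-elim)
open import Data.Fin as Fin using (Fin; toℕ; zero; suc; #_)
open import Data.Fin.Properties using (toℕ-injective; toℕ<n; toℕ-fromℕ<)
open import Data.Integer using (ℤ; +_; _-_; -_; ∣_∣) renaming (_⊖_ to _⊖ℤ_)
import Data.Integer.Properties as ZP
open import Data.Integer.Divisibility.Signed using (_∣_; divides; ∣ᵤ⇒∣; ∣⇒∣ᵤ; ∣m⇒∣-m; ∣m∣n⇒∣m+n; ∣m⇒∣m*n; ∣n⇒∣m*n)
import Data.Integer.Tactic.RingSolver as ℤ-Solver
open import Data.Nat as ℕ using (ℕ; zero; suc; NonZero; _<_; _≤_; z≤n; s≤s; _∸_; parity)
import Data.Nat.Divisibility as ℕ
import Data.Nat.Properties as NP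
open import Data.Nat.DivMod using (_mod_; _%_; _/_; m%n<n; m≡m%n+[m/n]*n; m<n⇒m%n≡m; %-remove-+ˡ)
open import Data.Nat.Primality using (Prime; euclidsLemma)
open import Data.Parity.Base as ℙ using (0ℙ; 1ℙ; _⁻¹)
open import Data.Parity.Properties as ℙ using (⁻¹-injective; p≢p⁻¹; p+p≡0ℙ; +-homo-+; *-homo-*)
open import Data.Product using (Σ; _×_; _,_; proj₁)
open import Data.Sum as Sum using (_⊎_; inj₁; inj₂; [_,_]′)
open import Relation.Binary.Bundles using (Setoid)
import Relation.Binary.Reasoning.Setoid
open import Relation.Binary.PropositionalEquality
open import Function using (_$_)
open import Relation.Nullary using (yes; no)
open import Relation.Binary.Definitions using (tri<; tri≈; tri>)
open import Defs

module Congruence (p : ℕ) where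
  open import Data.Integer using (_+_; _*_)
  open ℤ-Solver using (solve-∀)

  infix 4 _≈_
  record _≈_ (x y : ℤ) : Set where
    constructor mod-p
    field p∣x-y : + p ∣ x - y

  ≈-reflexive : ∀ {x y} → x ≡ y → x ≈ y
  ≈-reflexive {x} refl = mod-p (divides (+ 0) (ZP.+-inverseʳ x))

  ≈-refl : ∀ {x} → x ≈ x
  ≈-refl = ≈-reflexive refl

  ≈-sym : ∀ {x y} → x ≈ y → y ≈ x
  ≈-sym {x} {y} (mod-p h) = mod-p (subst (+ p ∣_) (lemma x y) (∣m⇒∣-m h))
    where lemma : ∀ x y → - (x - y) ≡ y - x
          lemma = solve-∀

  ≈-trans : ∀ {x y z} → x ≈ y → y ≈ z → x ≈ z
  ≈-trans {x} {y} {z} (mod-p h) (mod-p k) = mod-p (subst (+ p ∣_) (lemma x y z) (∣m∣n⇒∣m+n h k))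
    where lemma : ∀ x y z → (x - y) + (y - z) ≡ x - z
          lemma = solve-∀

  ≈-setoid : Setoid 0ℓ 0ℓ
  ≈-setoid = record
    { Carrier = ℤ ; _≈_ = _≈_
    ; isEquivalence = record { refl = ≈-refl ; sym = ≈-sym ; trans = ≈-trans } }

  module ≈-Reasoning = Relation.Binary.Reasoning.Setoid ≈-setoid

  +-cong : ∀ {x y u v} → x ≈ y → u ≈ v → x + u ≈ y + v
  +-cong {x} {y} {u} {v} (mod-p h) (mod-p k) = mod-p (subst (+ p ∣_) (lemma x y u v) (∣m∣n⇒∣m+n h k))
    where lemma : ∀ x y u v → (x - y) + (u - v) ≡ (x + u) - (y + v)
          lemma = solve-∀

  -‿cong : ∀ {x y} → x ≈ y → - x ≈ - y
  -‿cong {x} {y} (mod-p h) = mod-p (subst (+ p ∣_) (lemma x y) (∣m⇒∣-m h))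
    where lemma : ∀ x y → - (x - y) ≡ - x - - y
          lemma = solve-∀

  -‿cong₂ : ∀ {x y u v} → x ≈ y → u ≈ v → x - u ≈ y - v
  -‿cong₂ x≈y u≈v = +-cong x≈y (-‿cong u≈v)

  *-cong : ∀ {x y u v} → x ≈ y → u ≈ v → x * u ≈ y * v
  *-cong {x} {y} {u} {v} (mod-p h) (mod-p k) =
    mod-p (subst (+ p ∣_) (lemma x y u v) (∣m∣n⇒∣m+n (∣m⇒∣m*n u h) (∣n⇒∣m*n y k)))
    where lemma : ∀ x y u v → (x - y) * u + y * (u - v) ≡ x * u - y * v
          lemma = solve-∀

  ≈-+-multiple : ∀ x k → x ≈ x + k * + p
  ≈-+-multiple x k = mod-p (divides (- k) (lemma x k (+ p)))
    where lemma : ∀ x k q → x - (x + k * q) ≡ (- k) * q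
          lemma = solve-∀

  ≈⇒-≈0 : ∀ {x y} → x ≈ y → x - y ≈ + 0
  ≈⇒-≈0 {x} {y} (mod-p h) = mod-p (subst (+ p ∣_) (sym (ZP.+-identityʳ (x - y))) h)

  -≈0⇒≈ : ∀ {x y} → x - y ≈ + 0 → x ≈ y
  -≈0⇒≈ {x} {y} (mod-p h) = mod-p (subst (+ p ∣_) (ZP.+-identityʳ (x - y)) h)

  ≈-by-difference : ∀ {x y u v} → x - y ≡ u - v → u ≈ v → x ≈ y
  ≈-by-difference eq (mod-p h) = mod-p (subst (+ p ∣_) (sym eq) h)

  euclidsLemma-≈ : Prime p → ∀ x y → x * y ≈ + 0 → x ≈ + 0 ⊎ y ≈ + 0
  euclidsLemma-≈ p-prime x y (mod-p p∣xy) =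
    Sum.map ≈0-of-∣ ≈0-of-∣ (euclidsLemma ∣ x ∣ ∣ y ∣ p-prime p∣∣x∣*∣y∣)
    where
      p∣∣x∣*∣y∣ : p ℕ.∣ ∣ x ∣ ℕ.* ∣ y ∣
      p∣∣x∣*∣y∣ = subst (p ℕ.∣_) (trans (cong ∣_∣ (ZP.+-identityʳ (x * y))) (ZP.abs-* x y)) (∣⇒∣ᵤ p∣xy)
      ≈0-of-∣ : ∀ {z} → p ℕ.∣ ∣ z ∣ → z ≈ + 0
      ≈0-of-∣ {z} p∣z = mod-p (subst (+ p ∣_) (sym (ZP.+-identityʳ z)) (∣ᵤ⇒∣ p∣z))

module Residues (p : ℕ) .{{_ : NonZero p}} where
  open import Data.Integer using (_+_; _*_)
  open ℤ-Solver using (solve-∀)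

  open Congruence p

  toℤ : Fin p → ℤ
  toℤ a = + toℕ a

  toℤ-mod : ∀ m → toℤ (m mod p) ≈ + m
  toℤ-mod m = begin
    + toℕ (m mod p)                 ≡⟨ cong +_ (toℕ-fromℕ< (m%n<n m p)) ⟩
    + (m % p)                       ≈⟨ ≈-+-multiple (+ (m % p)) (+ (m / p)) ⟩
    + (m % p) + + (m / p) * + p     ≡⟨ cong (λ t → + (m % p) + t) (ZP.pos-* (m / p) p) ⟨
    + (m % p) + + (m / p ℕ.* p)     ≡⟨ ZP.pos-+ (m % p) (m / p ℕ.* p) ⟨
    + (m % p ℕ.+ m / p ℕ.* p)       ≡⟨ cong +_ (m≡m%n+[m/n]*n m p) ⟨
    + m                             ∎
    where open ≈-Reasoning

  toℤ-⊕ : ∀ a b → toℤ (_⊕_ p a b) ≈ toℤ a + toℤ b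
  toℤ-⊕ a b = ≈-trans (toℤ-mod _) (≈-reflexive (ZP.pos-+ (toℕ a) (toℕ b)))

  toℤ-⊗ : ∀ a b → toℤ (_⊗_ p a b) ≈ toℤ a * toℤ b
  toℤ-⊗ a b = ≈-trans (toℤ-mod _) (≈-reflexive (ZP.pos-* (toℕ a) (toℕ b)))

  toℤ-⊖ : ∀ a b → toℤ (_⊖_ p a b) ≈ toℤ a - toℤ b
  toℤ-⊖ a b = begin
    toℤ (_⊖_ p a b)                     ≈⟨ toℤ-mod _ ⟩
    + (toℕ a ℕ.+ (p ∸ toℕ b))            ≡⟨ ZP.pos-+ (toℕ a) (p ∸ toℕ b) ⟩
    toℤ a + + (p ∸ toℕ b)                ≡⟨ cong (λ t → toℤ a + t) (ZP.⊖-≥ (NP.<⇒≤ (toℕ<n b))) ⟨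
    toℤ a + (p ⊖ℤ toℕ b)                ≡⟨ cong (λ t → toℤ a + t) (ZP.m-n≡m⊖n p (toℕ b)) ⟨
    toℤ a + (+ p - toℤ b)                ≡⟨ lemma (toℤ a) (toℤ b) (+ p) ⟩
    (toℤ a - toℤ b) + + 1 * + p          ≈⟨ ≈-+-multiple (toℤ a - toℤ b) (+ 1) ⟨
    toℤ a - toℤ b                        ∎
    where open ≈-Reasoning
          lemma : ∀ a b q → a + (q - b) ≡ (a - b) + + 1 * q
          lemma = solve-∀

  ≈-residues⇒≡ : ∀ {m n} → m ≤ n → m < p → n < p → + m ≈ + n → m ≡ n
  ≈-residues⇒≡ {m} {n} m≤n m<p n<p (mod-p p∣m-n) = begin
    m                   ≡⟨ m<n⇒m%n≡m m<p ⟨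
    m % p               ≡⟨ %-remove-+ˡ m p∣n∸m ⟨
    (n ∸ m ℕ.+ m) % p   ≡⟨ cong (_% p) (NP.m∸n+n≡m m≤n) ⟩
    n % p               ≡⟨ m<n⇒m%n≡m n<p ⟩
    n                   ∎
    where
    open ≡-Reasoning
    p∣n∸m : p ℕ.∣ n ∸ m
    p∣n∸m = subst (p ℕ.∣_) (trans (cong ∣_∣ (ZP.m-n≡m⊖n m n)) (ZP.∣⊖∣-≤ m≤n)) (∣⇒∣ᵤ p∣m-n)

  toℤ-injective : ∀ {a b} → toℤ a ≈ toℤ b → a ≡ b
  toℤ-injective {a} {b} a≈b with NP.≤-total (toℕ a) (toℕ b)
  ... | inj₁ a≤b = toℕ-injective (≈-residues⇒≡ a≤b (toℕ<n a) (toℕ<n b) a≈b)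
  ... | inj₂ b≤a = sym (toℕ-injective (≈-residues⇒≡ b≤a (toℕ<n b) (toℕ<n a) (≈-sym a≈b)))

  ⊖-involutive : ∀ a x → _⊖_ p a (_⊖_ p a x) ≡ x
  ⊖-involutive a x = toℤ-injective (begin
    toℤ (_⊖_ p a (_⊖_ p a x))     ≈⟨ toℤ-⊖ a (_⊖_ p a x) ⟩
    toℤ a - toℤ (_⊖_ p a x)       ≈⟨ -‿cong₂ (≈-refl {toℤ a}) (toℤ-⊖ a x) ⟩
    toℤ a - (toℤ a - toℤ x)       ≡⟨ lemma (toℤ a) (toℤ x) ⟩
    toℤ x                         ∎)
    where open ≈-Reasoning
          lemma : ∀ a x → a - (a - x) ≡ x
          lemma = solve-∀

module VietaInvolutions (p : ℕ) .{{_ : NonZero p}} where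
  open Residues p

  coord : Fin 3 → Triple p → Fin p
  coord zero             (x , y , z) = x
  coord (suc zero)       (x , y , z) = y
  coord (suc (suc zero)) (x , y , z) = z

  AgreesOff : Fin 3 → Triple p → Triple p → Set
  AgreesOff e V W = ∀ t → t ≢ e → coord t V ≡ coord t W

  R-involutive : ∀ i V → R p i (R p i V) ≡ V
  R-involutive zero             (x , y , z) = cong (_, y , z) (⊖-involutive (_⊗_ p y z) x)
  R-involutive (suc zero)       (x , y , z) = cong (λ t → x , t , z) (⊖-involutive (_⊗_ p z x) y)
  R-involutive (suc (suc zero)) (x , y , z) = cong (λ t → x , y , t) (⊖-involutive (_⊗_ p x y) z)

  R-injective : ∀ i {V W} → R p i V ≡ R p i W → V ≡ W
  R-injective i {V} {W} eq = trans (sym (R-involutive i V)) (trans (cong (R p i) eq) (R-involutive i W))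

  Adj-sym : ∀ {V W} → Adj p V W → Adj p W V
  Adj-sym {V} (i , refl) = i , sym (R-involutive i V)

  coord-R : ∀ {t} i V → t ≢ i → coord t (R p i V) ≡ coord t V
  coord-R {zero}             zero             _ t≢i = ⊥-elim (t≢i refl)
  coord-R {suc zero}         (suc zero)       _ t≢i = ⊥-elim (t≢i refl)
  coord-R {suc (suc zero)}   (suc (suc zero)) _ t≢i = ⊥-elim (t≢i refl)
  coord-R {zero}             (suc zero)       _ _ = refl
  coord-R {zero}             (suc (suc zero)) _ _ = refl
  coord-R {suc zero}         zero             _ _ = refl
  coord-R {suc zero}         (suc (suc zero)) _ _ = refl
  coord-R {suc (suc zero)}   zero             _ _ = refl
  coord-R {suc (suc zero)}   (suc zero)       _ _ = refl

parity-suc : ∀ m → parity (suc m) ≡ parity m ⁻¹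
parity-suc m = +-homo-+ 1 m

parity-2* : ∀ n → parity (2 ℕ.* n) ≡ 0ℙ
parity-2* n = *-homo-* 2 n

parity-double : ∀ m → parity (m ℕ.+ m) ≡ 0ℙ
parity-double m = trans (+-homo-+ m m) (p+p≡0ℙ (parity m))

parity-+-≢ : ∀ a b → parity a ≢ parity b → parity (a ℕ.+ b) ≡ 1ℙ
parity-+-≢ a b a≢b = trans (+-homo-+ a b) (lemma (parity a) (parity b) a≢b)
  where lemma : ∀ x y → x ≢ y → x ℙ.+ y ≡ 1ℙ
        lemma 0ℙ 0ℙ x≢y = ⊥-elim (x≢y refl)
        lemma 0ℙ 1ℙ _ = refl
        lemma 1ℙ 0ℙ _ = refl
        lemma 1ℙ 1ℙ x≢y = ⊥-elim (x≢y refl)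

⁻¹≢⇒≡ : ∀ {x y} → x ⁻¹ ≢ y → x ≡ y
⁻¹≢⇒≡ {0ℙ} {0ℙ} _ = refl
⁻¹≢⇒≡ {1ℙ} {1ℙ} _ = refl
⁻¹≢⇒≡ {0ℙ} {1ℙ} x⁻¹≢y = ⊥-elim (x⁻¹≢y refl)
⁻¹≢⇒≡ {1ℙ} {0ℙ} x⁻¹≢y = ⊥-elim (x⁻¹≢y refl)

generator : Fin 3 → Fin 3 → ℕ → Fin 3
generator i j zero    = j
generator i j (suc m) = generator j i m

generator-parity : ∀ i j a b → parity a ≡ parity b → generator i j a ≡ generator i j b
generator-parity i j (suc (suc a)) b             eq = generator-parity i j a b eq
generator-parity i j a             (suc (suc b)) eq = generator-parity i j a b eq
generator-parity i j 0             0             _  = refl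
generator-parity i j 1             1             _  = refl
generator-parity i j 0             1             ()
generator-parity i j 1             0             ()

generator-even : ∀ i j m → parity m ≡ 0ℙ → generator i j m ≡ j
generator-even i j m even = generator-parity i j m 0 even

module AlternatingWalks (p : ℕ) .{{_ : NonZero p}} where
  open VietaInvolutions p

  alt-suc : ∀ i j W m → alt p i j W (suc m) ≡ R p (generator i j m) (alt p i j W m)
  alt-suc i j W zero    = refl
  alt-suc i j W (suc m) = alt-suc j i (R p j W) m

  alt-Adj : ∀ i j W m → Adj p (alt p i j W m) (alt p i j W (suc m))
  alt-Adj i j W m = generator i j m , alt-suc i j W m

  alt-+ : ∀ i j W a b →
          alt p i j W (a ℕ.+ b) ≡ alt p (generator j i a) (generator i j a) (alt p i j W a) b
  alt-+ i j W zero    b = refl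
  alt-+ i j W (suc a) b = alt-+ j i (R p j W) a b

  alt-coord : ∀ {t} i j W m → t ≢ i → t ≢ j → coord t (alt p i j W m) ≡ coord t W
  alt-coord i j W zero    _   _   = refl
  alt-coord i j W (suc m) t≢i t≢j = trans (alt-coord j i (R p j W) m t≢j t≢i) (coord-R j W t≢j)

  alt-repeat-sameParity : ∀ i j W a b → parity a ≡ parity b →
                          alt p i j W a ≡ alt p i j W b → W ≡ alt p i j W (b ∸ a)
  alt-repeat-sameParity i j W zero    b       _  eq = eq
  alt-repeat-sameParity i j W (suc a) zero    _  _  = refl
  alt-repeat-sameParity i j W (suc a) (suc b) pa≡pb eq =
    alt-repeat-sameParity i j W a b pa≡pb′ (R-injective (generator i j a) (begin
      R p (generator i j a) (alt p i j W a)   ≡⟨ alt-suc i j W a ⟨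
      alt p i j W (suc a)                     ≡⟨ eq ⟩
      alt p i j W (suc b)                     ≡⟨ alt-suc i j W b ⟩
      R p (generator i j b) (alt p i j W b)   ≡⟨ cong (λ g → R p g (alt p i j W b))
                                                     (generator-parity i j a b pa≡pb′) ⟨
      R p (generator i j a) (alt p i j W b)   ∎))
    where
    open ≡-Reasoning
    pa≡pb′ : parity a ≡ parity b
    pa≡pb′ = ⁻¹-injective (trans (sym (parity-suc a)) (trans pa≡pb (parity-suc b)))

  alt-repeat-oppositeParity : ∀ i j W a b → parity a ≢ parity b →
                              alt p i j W a ≡ alt p i j W b → W ≡ alt p i j W (a ℕ.+ b)
  alt-repeat-oppositeParity i j W zero    b _     eq = eq
  alt-repeat-oppositeParity i j W (suc a) b pa≢pb eq =
    subst (λ m → W ≡ alt p i j W m) (NP.+-suc a b)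
      (alt-repeat-oppositeParity i j W a (suc b) pa≢psb (begin
        alt p i j W a                          ≡⟨ R-involutive g (alt p i j W a) ⟨
        R p g (R p g (alt p i j W a))          ≡⟨ cong (R p g) (alt-suc i j W a) ⟨
        R p g (alt p i j W (suc a))            ≡⟨ cong (R p g) eq ⟩
        R p g (alt p i j W b)                  ≡⟨ cong (λ g → R p g (alt p i j W b)) (generator-parity i j a b pa≡pb) ⟩
        R p (generator i j b) (alt p i j W b)  ≡⟨ alt-suc i j W b ⟨
        alt p i j W (suc b)                    ∎))
    where
    open ≡-Reasoning
    g = generator i j a
    pa≡pb : parity a ≡ parity b
    pa≡pb = ⁻¹≢⇒≡ (λ e → pa≢pb (trans (parity-suc a) e))
    pa≢psb : parity a ≢ parity (suc b)
    pa≢psb e = p≢p⁻¹ (parity b) (trans (sym pa≡pb) (trans e (parity-suc b)))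

<⊎≡+ : ∀ L m → m < L ⊎ Σ ℕ (λ k → m ≡ L ℕ.+ k)
<⊎≡+ L m with m ℕ.<? L
... | yes m<L = inj₁ m<L
... | no  m≮L = let k , L+k≡m = NP.m≤n⇒∃[o]m+o≡n (NP.≮⇒≥ m≮L) in inj₂ (k , sym L+k≡m)

module Sequences {A : Set} (_∼_ : A → A → Set) where

  InjectiveBelow : ℕ → (ℕ → A) → Set
  InjectiveBelow L f = ∀ a b → a < b → b < L → f a ≢ f b

  Disjoint : ℕ → (ℕ → A) → ℕ → (ℕ → A) → Set
  Disjoint L f L′ g = ∀ a b → a < L → b < L′ → f a ≢ g b

  IsPath : ℕ → (ℕ → A) → Set
  IsPath L f = ∀ m → suc m < L → f m ∼ f (suc m)

  injectiveBelow⇒≡ : ∀ {L f} → InjectiveBelow L f → ∀ {a b} → a < L → b < L → f a ≡ f b → a ≡ b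
  injectiveBelow⇒≡ inj {a} {b} a<L b<L eq with NP.<-cmp a b
  ... | tri< a<b _ _ = ⊥-elim (inj a b a<b b<L eq)
  ... | tri≈ _ a≡b _ = a≡b
  ... | tri> _ _ b<a = ⊥-elim (inj b a b<a a<L (sym eq))

  infixr 5 _++⟨_⟩_
  _++⟨_⟩_ : (ℕ → A) → ℕ → (ℕ → A) → ℕ → A
  (f ++⟨ L ⟩ g) m with m ℕ.<? L
  ... | yes _ = f m
  ... | no  _ = g (m ∸ L)

  ++-< : ∀ f L g {m} → m < L → (f ++⟨ L ⟩ g) m ≡ f m
  ++-< f L g {m} m<L with m ℕ.<? L
  ... | yes _   = refl
  ... | no  m≮L = ⊥-elim (m≮L m<L)

  ++-+ : ∀ f L g m → (f ++⟨ L ⟩ g) (L ℕ.+ m) ≡ g m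
  ++-+ f L g m with (L ℕ.+ m) ℕ.<? L
  ... | yes L+m<L = ⊥-elim (NP.<⇒≱ L+m<L (NP.m≤m+n L m))
  ... | no  _     = cong g (NP.m+n∸m≡n L m)

  ++-all : ∀ {P : A → Set} f L g → (∀ m → P (f m)) → (∀ m → P (g m)) → ∀ m → P ((f ++⟨ L ⟩ g) m)
  ++-all f L g all-f all-g m with m ℕ.<? L
  ... | yes _ = all-f m
  ... | no  _ = all-g (m ∸ L)

  ++-disjointʳ : ∀ {L₀ h L₁ f L₂ g} → Disjoint L₀ h L₁ f → Disjoint L₀ h L₂ g →
                 Disjoint L₀ h (L₁ ℕ.+ L₂) (f ++⟨ L₁ ⟩ g)
  ++-disjointʳ {L₁ = L₁} {f} {L₂} {g} h#f h#g a b a<L₀ b<L eq with <⊎≡+ L₁ b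
  ... | inj₁ b<L₁        = h#f a b a<L₀ b<L₁ (trans eq (++-< f L₁ g b<L₁))
  ... | inj₂ (k , refl) = h#g a k a<L₀ (NP.+-cancelˡ-< L₁ k L₂ b<L) (trans eq (++-+ f L₁ g k))

  ++-injectiveBelow : ∀ {L₁ f L₂ g} → InjectiveBelow L₁ f → InjectiveBelow L₂ g → Disjoint L₁ f L₂ g →
                      InjectiveBelow (L₁ ℕ.+ L₂) (f ++⟨ L₁ ⟩ g)
  ++-injectiveBelow {L₁} {f} {L₂} {g} inj-f inj-g f#g a b a<b b<L eq with <⊎≡+ L₁ b
  ... | inj₁ b<L₁ =
    inj-f a b a<b b<L₁ (trans (sym (++-< f L₁ g (NP.<-trans a<b b<L₁))) (trans eq (++-< f L₁ g b<L₁)))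
  ... | inj₂ (k , refl) with <⊎≡+ L₁ a
  ...   | inj₁ a<L₁ =
    f#g a k a<L₁ (NP.+-cancelˡ-< L₁ k L₂ b<L) (trans (sym (++-< f L₁ g a<L₁)) (trans eq (++-+ f L₁ g k)))
  ...   | inj₂ (j , refl) =
    inj-g j k (NP.+-cancelˡ-< L₁ j k a<b) (NP.+-cancelˡ-< L₁ k L₂ b<L)
      (trans (sym (++-+ f L₁ g j)) (trans eq (++-+ f L₁ g k)))

  ++-isPath : ∀ {L₁ f L₂ g} → IsPath L₁ f → (∀ m → suc m ≡ L₁ → f m ∼ g 0) → IsPath L₂ g →
              IsPath (L₁ ℕ.+ L₂) (f ++⟨ L₁ ⟩ g)
  ++-isPath {L₁} {f} {L₂} {g} path-f junction path-g m 1+m<L with <⊎≡+ L₁ (suc m)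
  ... | inj₁ 1+m<L₁ =
    subst₂ _∼_ (sym (++-< f L₁ g (NP.<-trans (NP.n<1+n m) 1+m<L₁))) (sym (++-< f L₁ g 1+m<L₁)) (path-f m 1+m<L₁)
  ... | inj₂ (zero , 1+m≡L₁+0) =
    subst₂ _∼_ (sym (++-< f L₁ g (subst (m <_) 1+m≡L₁ (NP.n<1+n m))))
               (sym (trans (cong (f ++⟨ L₁ ⟩ g) 1+m≡L₁+0) (++-+ f L₁ g 0)))
      (junction m 1+m≡L₁)
    where 1+m≡L₁ = trans 1+m≡L₁+0 (NP.+-identityʳ L₁)
  ... | inj₂ (suc k , 1+m≡L₁+1+k) =
    subst₂ _∼_ (sym (trans (cong (f ++⟨ L₁ ⟩ g) m≡L₁+k) (++-+ f L₁ g k)))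
               (sym (trans (cong (f ++⟨ L₁ ⟩ g) 1+m≡L₁+1+k) (++-+ f L₁ g (suc k))))
      (path-g k (NP.+-cancelˡ-< L₁ (suc k) L₂ (subst (_< L₁ ℕ.+ L₂) 1+m≡L₁+1+k 1+m<L)))
    where m≡L₁+k = NP.suc-injective (trans 1+m≡L₁+1+k (NP.+-suc L₁ k))

  injectiveBelow-≤ : ∀ {L L′ f} → L ≤ L′ → InjectiveBelow L′ f → InjectiveBelow L f
  injectiveBelow-≤ L≤L′ inj a b a<b b<L = inj a b a<b (NP.<-≤-trans b<L L≤L′)

  Disjoint-sym : ∀ {L f L′ g} → Disjoint L f L′ g → Disjoint L′ g L f
  Disjoint-sym f#g a b a<L′ b<L eq = f#g b a b<L a<L′ (sym eq)

  reverse-injectiveBelow : ∀ {L f} → InjectiveBelow (suc L) f → InjectiveBelow (suc L) (λ m → f (L ∸ m))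
  reverse-injectiveBelow {L} inj a b a<b b<1+L eq =
    inj (L ∸ b) (L ∸ a) (NP.∸-monoʳ-< a<b (ℕ.s≤s⁻¹ b<1+L)) (s≤s (NP.m∸n≤m L a)) (sym eq)

  reverse-isPath : ∀ {L f} → (∀ {x y} → x ∼ y → y ∼ x) → IsPath (suc L) f → IsPath L (λ m → f (L ∸ m))
  reverse-isPath {L} {f} sym-∼ path m 1+m<L =
    subst (λ k → f k ∼ f (L ∸ suc m)) (sym L∸m≡1+L∸[1+m])
      (sym-∼ (path (L ∸ suc m) (s≤s (subst (_≤ L) L∸m≡1+L∸[1+m] (NP.m∸n≤m L m)))))
    where L∸m≡1+L∸[1+m] : L ∸ m ≡ suc (L ∸ suc m)
          L∸m≡1+L∸[1+m] = NP.+-∸-assoc 1 (NP.<-trans (NP.n<1+n m) 1+m<L)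

module MarkoffSurface (p : ℕ) .{{_ : NonZero p}} (p-prime : Prime p) (κ : ℤ) where
  open import Data.Integer using (_+_; _*_)
  open ℤ-Solver using (solve-∀)

  open Congruence p
  open Residues p
  open VietaInvolutions p
  open Sequences (Adj p)

  markoff : ℤ → ℤ → ℤ → ℤ
  markoff x y z = x * x + y * y + z * z - (x * y * z + toℤ (⟦_⟧ p κ))

  markoff-rotate : ∀ x y z → markoff x y z ≡ markoff y z x
  markoff-rotate x y z = lemma x y z (toℤ (⟦_⟧ p κ))
    where lemma : ∀ x y z c → x * x + y * y + z * z - (x * y * z + c) ≡ y * y + z * z + x * x - (y * z * x + c)
          lemma = solve-∀

  markoff-difference : ∀ x x′ y z → markoff x′ y z - markoff x y z ≡ (x′ - x) * (x′ + x - y * z)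
  markoff-difference x x′ y z = lemma x x′ y z (toℤ (⟦_⟧ p κ))
    where lemma : ∀ x x′ y z c → x′ * x′ + y * y + z * z - (x′ * y * z + c)
                                   - (x * x + y * y + z * z - (x * y * z + c))
                                 ≡ (x′ - x) * (x′ + x - y * z)
          lemma = solve-∀

  markoff-reflect : ∀ x y z → markoff (y * z - x) y z ≡ markoff x y z
  markoff-reflect x y z = lemma x y z (toℤ (⟦_⟧ p κ))
    where lemma : ∀ x y z c → (y * z - x) * (y * z - x) + y * y + z * z - ((y * z - x) * y * z + c)
                              ≡ x * x + y * y + z * z - (x * y * z + c)
          lemma = solve-∀

  markoff-cong : ∀ {x x′} y z → x ≈ x′ → markoff x y z ≈ markoff x′ y z
  markoff-cong y z x≈x′ =
    -‿cong₂ (+-cong (+-cong (*-cong x≈x′ x≈x′) ≈-refl) ≈-refl) (+-cong (*-cong (*-cong x≈x′ ≈-refl) ≈-refl) ≈-refl)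

  record Root (x y z : Fin p) : Set where
    constructor root
    field markoff≈0 : markoff (toℤ x) (toℤ y) (toℤ z) ≈ + 0

  Root-rotate : ∀ {x y z} → Root x y z → Root y z x
  Root-rotate {x} {y} {z} (root r) = root (subst (_≈ + 0) (markoff-rotate (toℤ x) (toℤ y) (toℤ z)) r)

  toℤ-sumOfSquares : ∀ x y z →
    toℤ (_⊕_ p (_⊕_ p (_⊗_ p x x) (_⊗_ p y y)) (_⊗_ p z z)) ≈ toℤ x * toℤ x + toℤ y * toℤ y + toℤ z * toℤ z
  toℤ-sumOfSquares x y z =
    ≈-trans (toℤ-⊕ (_⊕_ p (_⊗_ p x x) (_⊗_ p y y)) (_⊗_ p z z))
      (+-cong (≈-trans (toℤ-⊕ (_⊗_ p x x) (_⊗_ p y y)) (+-cong (toℤ-⊗ x x) (toℤ-⊗ y y))) (toℤ-⊗ z z))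

  toℤ-product+κ : ∀ x y z →
    toℤ (_⊕_ p (_⊗_ p (_⊗_ p x y) z) (⟦_⟧ p κ)) ≈ toℤ x * toℤ y * toℤ z + toℤ (⟦_⟧ p κ)
  toℤ-product+κ x y z = ≈-trans (toℤ-⊕ (_⊗_ p (_⊗_ p x y) z) (⟦_⟧ p κ))
    (+-cong (≈-trans (toℤ-⊗ (_⊗_ p x y) z) (*-cong (toℤ-⊗ x y) ≈-refl)) ≈-refl)

  InM⇒Root : ∀ {x y z} → InM p κ (x , y , z) → Root x y z
  InM⇒Root {x} {y} {z} eq = root $
    ≈⇒-≈0 (≈-trans (≈-sym (toℤ-sumOfSquares x y z)) (≈-trans (≈-reflexive (cong toℤ eq)) (toℤ-product+κ x y z)))

  Root⇒InM : ∀ {x y z} → Root x y z → InM p κ (x , y , z)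
  Root⇒InM {x} {y} {z} (root r) =
    toℤ-injective (≈-trans (toℤ-sumOfSquares x y z) (≈-trans (-≈0⇒≈ r) (≈-sym (toℤ-product+κ x y z))))

  otherRoot : Fin p → Fin p → Fin p → Fin p
  otherRoot s t u = _⊖_ p (_⊗_ p s t) u

  toℤ-otherRoot : ∀ s t u → toℤ (otherRoot s t u) ≈ toℤ s * toℤ t - toℤ u
  toℤ-otherRoot s t u = ≈-trans (toℤ-⊖ (_⊗_ p s t) u) (-‿cong₂ (toℤ-⊗ s t) ≈-refl)

  Root-otherRoot : ∀ {u s t} → Root u s t → Root (otherRoot s t u) s t
  Root-otherRoot {u} {s} {t} (root r) = root $
    ≈-trans (markoff-cong (toℤ s) (toℤ t) (toℤ-otherRoot s t u))
            (subst (_≈ + 0) (sym (markoff-reflect (toℤ u) (toℤ s) (toℤ t))) r)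

  Root-unique : ∀ {u v s t} → Root u s t → Root v s t → u ≡ v ⊎ u ≡ otherRoot s t v
  Root-unique {u} {v} {s} {t} (root root-u) (root root-v) =
    Sum.map (λ u-v≈0 → toℤ-injective (-≈0⇒≈ u-v≈0))
            (λ u+v-st≈0 → toℤ-injective (≈-trans (≈-by-difference (lemma U V S T) u+v-st≈0)
                                                 (≈-sym (toℤ-otherRoot s t v))))
            (euclidsLemma-≈ p-prime (U - V) (U + V - S * T)
              (≈-by-difference (trans (ZP.+-identityʳ ((U - V) * (U + V - S * T))) (sym (markoff-difference V U S T)))
                               (≈-trans root-u (≈-sym root-v))))
    where
    U = toℤ u; V = toℤ v; S = toℤ s; T = toℤ t
    lemma : ∀ u v s t → u - (s * t - v) ≡ u + v - s * t - + 0
    lemma = solve-∀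

  R-preserves-InM : ∀ i {V} → InM p κ V → InM p κ (R p i V)
  R-preserves-InM zero             {x , y , z} inM =
    Root⇒InM {otherRoot y z x} (Root-otherRoot xyz)
    where xyz = InM⇒Root {x} {y} {z} inM
  R-preserves-InM (suc zero)       {x , y , z} inM =
    Root⇒InM {x} {otherRoot z x y} (Root-rotate (Root-rotate (Root-otherRoot (Root-rotate xyz))))
    where xyz = InM⇒Root {x} {y} {z} inM
  R-preserves-InM (suc (suc zero)) {x , y , z} inM =
    Root⇒InM {x} {y} {otherRoot x y z} (Root-rotate (Root-otherRoot (Root-rotate (Root-rotate xyz))))
    where xyz = InM⇒Root {x} {y} {z} inM

  InM-line : ∀ e {V W} → InM p κ V → InM p κ W → AgreesOff e V W → V ≡ W ⊎ V ≡ R p e W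
  InM-line zero {x′ , y′ , z′} {x , y , z} inV inW agree
    with agree (suc zero) (λ ()) | agree (suc (suc zero)) (λ ())
  ... | refl | refl = Sum.map (cong (_, y , z)) (cong (_, y , z))
                        (Root-unique (InM⇒Root {x′} {y} {z} inV) (InM⇒Root {x} {y} {z} inW))
  InM-line (suc zero) {x′ , y′ , z′} {x , y , z} inV inW agree
    with agree zero (λ ()) | agree (suc (suc zero)) (λ ())
  ... | refl | refl = Sum.map (cong (λ t → x , t , z)) (cong (λ t → x , t , z))
                        (Root-unique (Root-rotate (InM⇒Root {x} {y′} {z} inV))
                                     (Root-rotate (InM⇒Root {x} {y} {z} inW)))
  InM-line (suc (suc zero)) {x′ , y′ , z′} {x , y , z} inV inW agree
    with agree zero (λ ()) | agree (suc zero) (λ ())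
  ... | refl | refl = Sum.map (cong (λ t → x , y , t)) (cong (λ t → x , y , t))
                        (Root-unique (Root-rotate (Root-rotate (InM⇒Root {x} {y} {z′} inV)))
                                     (Root-rotate (Root-rotate (InM⇒Root {x} {y} {z} inW))))

  alt-preserves-InM : ∀ i j {W} m → InM p κ W → InM p κ (alt p i j W m)
  alt-preserves-InM i j zero    inM = inM
  alt-preserves-InM i j (suc m) inM = alt-preserves-InM j i m (R-preserves-InM j inM)

  closedPath⇒HasCycle : ∀ L f → (∀ m → InM p κ (f m)) → InjectiveBelow L f → IsPath L f →
                        (∀ m → suc m ≡ L → Adj p (f m) (f 0)) → HasCycle p κ L
  closedPath⇒HasCycle L f inM inj path close =
    (λ k → f (toℕ k)) , (λ k → inM (toℕ k)) , injective , adjacent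
    where
    injective : ∀ {k k′ : Fin L} → f (toℕ k) ≡ f (toℕ k′) → k ≡ k′
    injective eq = toℕ-injective (injectiveBelow⇒≡ inj (toℕ<n _) (toℕ<n _) eq)
    adjacent : ∀ (k k′ : Fin L) → suc (toℕ k) ≡ toℕ k′ ⊎ (suc (toℕ k) ≡ L × toℕ k′ ≡ 0) →
               Adj p (f (toℕ k)) (f (toℕ k′))
    adjacent k k′ (inj₁ next) =
      subst (λ m → Adj p (f (toℕ k)) (f m)) next (path (toℕ k) (subst (_< L) (sym next) (toℕ<n k′)))
    adjacent k k′ (inj₂ (last , k′≡0)) =
      subst (λ m → Adj p (f (toℕ k)) (f m)) (sym k′≡0) (close (toℕ k) last)

open import Data.Nat using (_+_; _*_)
open import Data.Nat.Tactic.RingSolver using (solve-∀)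

module ProperSextuple
  (p : ℕ) .{{_ : NonZero p}} (p-prime : Prime p) (κ : ℤ) (n : ℕ) (X Y : Fin 3 → Triple p)
  (X∈M         : ∀ i → InM p κ (X i))
  (Y≡RX        : ∀ j → Y j ≡ R p j (X j))
  (path-end    : ∀ i j → i ≢ j → alt p i j (X i) (2 * n) ≡ Y j)
  (X-injective : ∀ {i j} → X i ≡ X j → i ≡ j)
  (X≢Y         : ∀ i k → X i ≢ Y k)
  (interior≢X  : ∀ i j → i ≢ j → ∀ m → 0 < m → m < 2 * n → ∀ k → alt p i j (X i) m ≢ X k)
  where

  open VietaInvolutions p
  open AlternatingWalks p
  open Sequences (Adj p)
  open MarkoffSurface p p-prime κ

  ℓ S N : ℕ
  ℓ = 2 * n
  S = suc ℓ
  N = S + S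

  path : Fin 3 → Fin 3 → ℕ → Triple p
  path i j = alt p i j (X i)

  path-S : ∀ {i j} → i ≢ j → path i j S ≡ X j
  path-S {i} {j} i≢j = begin
    path i j (suc ℓ)                    ≡⟨ alt-suc i j (X i) ℓ ⟩
    R p (generator i j ℓ) (path i j ℓ)  ≡⟨ cong₂ (R p) (generator-even i j ℓ (parity-2* n)) (path-end i j i≢j) ⟩
    R p j (Y j)                         ≡⟨ cong (R p j) (Y≡RX j) ⟩
    R p j (R p j (X j))                 ≡⟨ R-involutive j (X j) ⟩
    X j                                 ∎
    where open ≡-Reasoning

  path-S+ : ∀ {i j} → i ≢ j → ∀ m → path i j (S + m) ≡ path j i m
  path-S+ {i} {j} i≢j m = begin
    path i j (S + m)                                          ≡⟨ alt-+ i j (X i) S m ⟩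
    alt p (generator i j ℓ) (generator j i ℓ) (path i j S) m  ≡⟨ cong₂ (λ a b → alt p a b (path i j S) m)
                                                                   (generator-even i j ℓ (parity-2* n))
                                                                   (generator-even j i ℓ (parity-2* n)) ⟩
    alt p j i (path i j S) m                                  ≡⟨ cong (λ W → alt p j i W m) (path-S i≢j) ⟩
    path j i m                                                ∎
    where open ≡-Reasoning

  path-N : ∀ {i j} → i ≢ j → path i j N ≡ X i
  path-N i≢j = trans (path-S+ i≢j S) (path-S (≢-sym i≢j))

  path-S+ℓ : ∀ {i j} → i ≢ j → path i j (S + ℓ) ≡ Y i
  path-S+ℓ {i} {j} i≢j = trans (path-S+ i≢j ℓ) (path-end j i (≢-sym i≢j))

  path-N+ : ∀ {i j} → i ≢ j → ∀ m → path i j (N + m) ≡ path i j m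
  path-N+ {i} {j} i≢j m = begin
    path i j (N + m)                                          ≡⟨ alt-+ i j (X i) N m ⟩
    alt p (generator j i N) (generator i j N) (path i j N) m  ≡⟨ cong₂ (λ a b → alt p a b (path i j N) m)
                                                                   (generator-even j i N (parity-double S))
                                                                   (generator-even i j N (parity-double S)) ⟩
    alt p i j (path i j N) m                                  ≡⟨ cong (λ W → alt p i j W m) (path-N i≢j) ⟩
    path i j m                                                ∎
    where open ≡-Reasoning

  path-isPath : ∀ i j L → IsPath L (path i j)
  path-isPath i j L m _ = alt-Adj i j (X i) m

  path-∈M : ∀ i j m → InM p κ (path i j m)
  path-∈M i j m = alt-preserves-InM i j m (X∈M i)

  path-≢X : ∀ {i j} → i ≢ j → ∀ m k → 0 < m → m ≤ ℓ → path i j m ≢ X k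
  path-≢X {i} {j} i≢j m k 0<m m≤ℓ with NP.m≤n⇒m<n∨m≡n m≤ℓ
  ... | inj₁ m<ℓ  = interior≢X i j i≢j m 0<m m<ℓ k
  ... | inj₂ refl = λ Yj≡Xk → X≢Y k j (sym (trans (sym (path-end i j i≢j)) Yj≡Xk))

  path-X-only-at-0 : ∀ {i j} → i ≢ j → ∀ m → m < N → path i j m ≡ X i → m ≡ 0
  path-X-only-at-0 i≢j zero    _   _ = refl
  path-X-only-at-0 {i} {j} i≢j (suc m) 1+m<N eq with <⊎≡+ S (suc m)
  ... | inj₁ 1+m<S = ⊥-elim (path-≢X i≢j (suc m) i (s≤s z≤n) (ℕ.s≤s⁻¹ 1+m<S) eq)
  ... | inj₂ (zero , 1+m≡S+0) =
    ⊥-elim (≢-sym i≢j (X-injective (trans (sym (path-S i≢j)) (trans (cong (path i j) (sym 1+m≡S)) eq))))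
    where 1+m≡S = trans 1+m≡S+0 (NP.+-identityʳ S)
  ... | inj₂ (suc k , 1+m≡S+1+k) =
    ⊥-elim (path-≢X (≢-sym i≢j) (suc k) i (s≤s z≤n) 1+k≤ℓ
      (trans (sym (path-S+ i≢j (suc k))) (trans (cong (path i j) (sym 1+m≡S+1+k)) eq)))
    where 1+k≤ℓ = ℕ.s≤s⁻¹ (NP.+-cancelˡ-< S (suc k) S (subst (_< N) 1+m≡S+1+k 1+m<N))

  path-injectiveBelow : ∀ {i j} → i ≢ j → InjectiveBelow N (path i j)
  path-injectiveBelow {i} {j} i≢j a b a<b b<N eq with parity a ℙ.≟ parity b
  ... | yes same =
    NP.<⇒≢ (NP.m<n⇒0<n∸m a<b)
      (sym (path-X-only-at-0 i≢j (b ∸ a) (NP.≤-<-trans (NP.m∸n≤m b a) b<N)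
        (sym (alt-repeat-sameParity i j (X i) a b same eq))))
  ... | no opposite with <⊎≡+ N (a + b)
  ...   | inj₁ a+b<N =
    NP.n≮0 (subst (a <_) (NP.m+n≡0⇒n≡0 a (path-X-only-at-0 i≢j (a + b) a+b<N (sym Xi≡a+b))) a<b)
    where Xi≡a+b = alt-repeat-oppositeParity i j (X i) a b opposite eq
  ...   | inj₂ (k , a+b≡N+k) = 1ℙ≢0ℙ (begin
    1ℙ              ≡⟨ parity-+-≢ a b opposite ⟨
    parity (a + b)  ≡⟨ cong parity (trans a+b≡N+k (cong (λ k → N + k) k≡0)) ⟩
    parity (N + 0)  ≡⟨ cong parity (NP.+-identityʳ N) ⟩
    parity N        ≡⟨ parity-double S ⟩
    0ℙ              ∎)
    where
    open ≡-Reasoning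
    1ℙ≢0ℙ : 1ℙ ≢ 0ℙ
    1ℙ≢0ℙ ()
    k<N : k < N
    k<N = NP.+-cancelˡ-< N k N (subst (_< N + N) a+b≡N+k (NP.+-mono-< (NP.<-trans a<b b<N) b<N))
    k≡0 : k ≡ 0
    k≡0 = path-X-only-at-0 i≢j k k<N (sym (begin
      X i               ≡⟨ alt-repeat-oppositeParity i j (X i) a b opposite eq ⟩
      path i j (a + b)  ≡⟨ cong (path i j) a+b≡N+k ⟩
      path i j (N + k)  ≡⟨ path-N+ i≢j k ⟩
      path i j k        ∎))

  S<N : S < N
  S<N = NP.m<m+n S (s≤s z≤n)

  S+ℓ<N : S + ℓ < N
  S+ℓ<N = NP.+-monoʳ-< S (NP.n<1+n ℓ)

  path-Xj-at-S : ∀ {i j a} → i ≢ j → a < N → path i j a ≡ X j → a ≡ S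
  path-Xj-at-S i≢j a<N eq = injectiveBelow⇒≡ (path-injectiveBelow i≢j) a<N S<N (trans eq (sym (path-S i≢j)))

  path-Yi-at-S+ℓ : ∀ {i j a} → i ≢ j → a < N → path i j a ≡ Y i → a ≡ S + ℓ
  path-Yi-at-S+ℓ i≢j a<N eq = injectiveBelow⇒≡ (path-injectiveBelow i≢j) a<N S+ℓ<N (trans eq (sym (path-S+ℓ i≢j)))

  X-coord : ∀ {t i j} → t ≢ i → t ≢ j → i ≢ j → coord t (X j) ≡ coord t (X i)
  X-coord {t} {i} {j} t≢i t≢j i≢j = trans (cong (coord t) (sym (path-S i≢j))) (alt-coord i j (X i) S t≢i t≢j)

  agreesOff-X⇒X⊎Y : ∀ e {V} → InM p κ V → AgreesOff e V (X e) → V ≡ X e ⊎ V ≡ Y e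
  agreesOff-X⇒X⊎Y e inV agree = Sum.map₂ (λ V≡RX → trans V≡RX (sym (Y≡RX e))) (InM-line e inV (X∈M e) agree)

  junction-agreesOff : ∀ {i j k a b} → i ≢ j → j ≢ k → i ≢ k → path i j a ≡ path j k b →
                       AgreesOff j (path i j a) (X j)
  junction-agreesOff {i} {j} {k} {a} {b} i≢j j≢k i≢k eq t t≢j with t Fin.≟ i
  ... | yes refl = trans (cong (coord i) eq) (alt-coord j k (X j) b i≢j i≢k)
  ... | no  t≢i  = trans (alt-coord i j (X i) a t≢i t≢j) (sym (X-coord t≢i t≢j i≢j))

  fork-agreesOff : ∀ {i j k a c} → i ≢ j → j ≢ k → path i j a ≡ path i k c → AgreesOff i (path i k c) (X i)
  fork-agreesOff {i} {j} {k} {a} {c} i≢j j≢k eq t t≢i with t Fin.≟ j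
  ... | yes refl = alt-coord i k (X i) c (≢-sym i≢j) j≢k
  ... | no  t≢j  = trans (cong (coord t) (sym eq)) (alt-coord i j (X i) a t≢i t≢j)

  consecutive-paths-disjoint : ∀ {i j k} → i ≢ j → j ≢ k → i ≢ k → Disjoint S (path i j) S (path j k)
  consecutive-paths-disjoint {i} {j} {k} i≢j j≢k i≢k a b a<S b<S eq =
    [ (λ at-Xj → NP.<⇒≢ a<S (path-Xj-at-S i≢j a<N at-Xj))
    , (λ at-Yj → NP.<⇒≱ b<S (subst (S ≤_) (sym (path-Yi-at-S+ℓ j≢k b<N (trans (sym eq) at-Yj))) (NP.m≤m+n S ℓ)))
    ]′ (agreesOff-X⇒X⊎Y j (path-∈M i j a) (junction-agreesOff {a = a} {b} i≢j j≢k i≢k eq))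
    where a<N = NP.<-trans a<S S<N
          b<N = NP.<-trans b<S S<N

  fork-disjoint : ∀ {i j k} → i ≢ j → j ≢ k → i ≢ k →
                  ∀ a c → a < N → 0 < c → c < S + ℓ → path i j a ≢ path i k c
  fork-disjoint {i} {j} {k} i≢j j≢k i≢k a c a<N 0<c c<S+ℓ eq =
    [ (λ at-Xi → NP.<⇒≢ 0<c (sym (path-X-only-at-0 i≢k c c<N at-Xi)))
    , (λ at-Yi → NP.<⇒≢ c<S+ℓ (path-Yi-at-S+ℓ i≢k c<N at-Yi))
    ]′ (agreesOff-X⇒X⊎Y i (path-∈M i k c) (fork-agreesOff {a = a} {c} i≢j j≢k eq))
    where c<N = NP.<-trans c<S+ℓ S+ℓ<N

  path-Adj-to : ∀ i j m {V} → path i j (suc m) ≡ V → Adj p (path i j m) V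
  path-Adj-to i j m eq = subst (Adj p (path i j m)) eq (alt-Adj i j (X i) m)

  path-injectiveBelow-S : ∀ {i j} → i ≢ j → InjectiveBelow S (path i j)
  path-injectiveBelow-S i≢j = injectiveBelow-≤ (NP.<⇒≤ S<N) (path-injectiveBelow i≢j)

  cycle-4n+2 : HasCycle p κ N
  cycle-4n+2 = closedPath⇒HasCycle N (path (# 0) (# 1)) (path-∈M (# 0) (# 1)) (path-injectiveBelow (λ ()))
    (path-isPath _ _ N)
    (λ m 1+m≡N → path-Adj-to (# 0) (# 1) m (trans (cong (path (# 0) (# 1)) 1+m≡N) (path-N (λ ()))))

  triangle : ℕ → Triple p
  triangle = path (# 0) (# 2) ++⟨ S ⟩ path (# 2) (# 1) ++⟨ S ⟩ path (# 1) (# 0)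

  cycle-6n+3 : HasCycle p κ (S + (S + S))
  cycle-6n+3 = closedPath⇒HasCycle (S + (S + S)) triangle
    (++-all {InM p κ} (path (# 0) (# 2)) S _ (path-∈M (# 0) (# 2))
      (++-all {InM p κ} (path (# 2) (# 1)) S _ (path-∈M (# 2) (# 1)) (path-∈M (# 1) (# 0))))
    (++-injectiveBelow (path-injectiveBelow-S (λ ()))
      (++-injectiveBelow (path-injectiveBelow-S (λ ())) (path-injectiveBelow-S (λ ()))
        (consecutive-paths-disjoint (λ ()) (λ ()) (λ ())))
      (++-disjointʳ (consecutive-paths-disjoint (λ ()) (λ ()) (λ ()))
        (Disjoint-sym (consecutive-paths-disjoint (λ ()) (λ ()) (λ ())))))
    (++-isPath (path-isPath _ _ S) enter-second (++-isPath (path-isPath _ _ S) enter-third (path-isPath _ _ S)))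
    close
    where
    enter : ∀ {i j} → i ≢ j → ∀ m → suc m ≡ S → Adj p (path i j m) (X j)
    enter {i} {j} i≢j m 1+m≡S = path-Adj-to i j m (trans (cong (path i j) 1+m≡S) (path-S i≢j))
    enter-second : ∀ m → suc m ≡ S → Adj p (path (# 0) (# 2) m) ((path (# 2) (# 1) ++⟨ S ⟩ path (# 1) (# 0)) 0)
    enter-second m 1+m≡S =
      subst (Adj p _) (sym (++-< (path (# 2) (# 1)) S (path (# 1) (# 0)) (s≤s z≤n))) (enter (λ ()) m 1+m≡S)
    enter-third : ∀ m → suc m ≡ S → Adj p (path (# 2) (# 1) m) (path (# 1) (# 0) 0)
    enter-third = enter (λ ())
    close : ∀ m → suc m ≡ S + (S + S) → Adj p (triangle m) (triangle 0)
    close m 1+m≡3S = subst₂ (Adj p) (sym last≡) (sym first≡) (enter (λ ()) ℓ refl)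
      where
      first≡ : triangle 0 ≡ X (# 0)
      first≡ = ++-< (path (# 0) (# 2)) S (path (# 2) (# 1) ++⟨ S ⟩ path (# 1) (# 0)) (s≤s z≤n)
      m≡ : m ≡ S + (S + ℓ)
      m≡ = NP.suc-injective (trans 1+m≡3S (trans (cong (λ k → S + k) (NP.+-suc S ℓ)) (NP.+-suc S (S + ℓ))))
      last≡ : triangle m ≡ path (# 1) (# 0) ℓ
      last≡ = trans (cong triangle m≡) (trans (++-+ _ S _ (S + ℓ)) (++-+ _ S _ ℓ))

  M : ℕ
  M = ℓ + ℓ

  backwards : ℕ → Triple p
  backwards m = path (# 1) (# 2) (M ∸ m)

  detour : ℕ → Triple p
  detour = path (# 1) (# 0) ++⟨ N ⟩ backwards

  cycle-8n+2 : 0 < n → HasCycle p κ (N + M)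
  cycle-8n+2 0<n = closedPath⇒HasCycle (N + M) detour
    (++-all {InM p κ} (path (# 1) (# 0)) N backwards (path-∈M (# 1) (# 0)) (λ m → path-∈M (# 1) (# 2) (M ∸ m)))
    (++-injectiveBelow (path-injectiveBelow (λ ()))
      (injectiveBelow-≤ (NP.n≤1+n M)
        (reverse-injectiveBelow (injectiveBelow-≤ (NP.<⇒≤ S+ℓ<N) (path-injectiveBelow (λ ())))))
      (λ a b a<N b<M → fork-disjoint (λ ()) (λ ()) (λ ()) a (M ∸ b) a<N (NP.m<n⇒0<n∸m b<M) (s≤s (NP.m∸n≤m M b))))
    (++-isPath (path-isPath _ _ N) turn (reverse-isPath Adj-sym (path-isPath (# 1) (# 2) (suc M))))
    close
    where
    turn : ∀ m → suc m ≡ N → Adj p (path (# 1) (# 0) m) (backwards 0)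
    turn m 1+m≡N = Adj-sym (path-Adj-to (# 1) (# 2) M (begin
      path (# 1) (# 2) (S + ℓ)  ≡⟨ path-S+ℓ (λ ()) ⟩
      Y (# 1)                   ≡⟨ path-S+ℓ (λ ()) ⟨
      path (# 1) (# 0) (S + ℓ)  ≡⟨ cong (path (# 1) (# 0)) (NP.suc-injective (trans 1+m≡N (NP.+-suc S ℓ))) ⟨
      path (# 1) (# 0) m        ∎))
      where open ≡-Reasoning
    0<M : 0 < M
    0<M = NP.<-≤-trans (NP.*-monoʳ-< 2 0<n) (NP.m≤m+n ℓ ℓ)
    close : ∀ m → suc m ≡ N + M → Adj p (detour m) (detour 0)
    close m 1+m≡N+M = subst₂ (Adj p) (sym last≡) (sym (++-< (path (# 1) (# 0)) N backwards (s≤s z≤n)))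
                        (Adj-sym (alt-Adj (# 1) (# 2) (X (# 1)) 0))
      where
      k = ℕ.pred M
      1+k≡M : suc k ≡ M
      1+k≡M = NP.suc-pred M {{ℕ.>-nonZero 0<M}}
      m≡N+k : m ≡ N + k
      m≡N+k = NP.suc-injective (trans 1+m≡N+M (trans (cong (λ k → N + k) (sym 1+k≡M)) (NP.+-suc N k)))
      last≡ : detour m ≡ path (# 1) (# 2) 1
      last≡ = begin
        detour m                      ≡⟨ cong detour m≡N+k ⟩
        detour (N + k)                ≡⟨ ++-+ (path (# 1) (# 0)) N backwards k ⟩
        path (# 1) (# 2) (M ∸ k)      ≡⟨ cong (λ L → path (# 1) (# 2) (L ∸ k)) 1+k≡M ⟨
        path (# 1) (# 2) (suc k ∸ k)  ≡⟨ cong (path (# 1) (# 2)) (NP.m+n∸n≡m 1 k) ⟩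
        path (# 1) (# 2) 1            ∎
        where open ≡-Reasoning

corollary3p4 : (p : ℕ) .{{_ : NonZero p}} → Prime p → 3 < p → (κ : ℤ) →
    (n : ℕ) → 0 < n →
    (Σ (Fin 3 → Triple p) λ X → Σ (Fin 3 → Triple p) λ Y → InKprop p n κ X Y) →
    HasCycle p κ (4 * n + 2) × HasCycle p κ (6 * n + 3) × HasCycle p κ (8 * n + 2)
corollary3p4 p p-prime _ κ n 0<n (X , Y , (X∈M , _ , Y≡RX , path-end) , X-injective , _ , X≢Y , interior≢) =
  subst (HasCycle p κ) (4n+2 n) cycle-4n+2 ,
  subst (HasCycle p κ) (6n+3 n) cycle-6n+3 ,
  subst (HasCycle p κ) (8n+2 n) (cycle-8n+2 0<n)
  where
  open ProperSextuple p p-prime κ n X Y X∈M Y≡RX path-end X-injective X≢Y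
         (λ i j i≢j m 0<m m<ℓ k → proj₁ (interior≢ i j i≢j m 0<m m<ℓ k))
  4n+2 : ∀ n → suc (2 * n) + suc (2 * n) ≡ 4 * n + 2
  4n+2 = solve-∀
  6n+3 : ∀ n → suc (2 * n) + (suc (2 * n) + suc (2 * n)) ≡ 6 * n + 3
  6n+3 = solve-∀
  8n+2 : ∀ n → suc (2 * n) + suc (2 * n) + (2 * n + 2 * n) ≡ 8 * n + 2
  8n+2 = solve-∀
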